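{- For $\sigma\in\{132,213,231,312\}$ and $n\in\mathbb{N}$, \[ |\mathscr{G}_n(\sigma)| = 1+\binom{n}{2}. \]
   Context: A permutation is Grassmannian if it has at most one descent (a position $i$ with $\pi(i)>\pi(i+1)$); $\mathscr{G}_n$ is the set of Grassmannian permutations of $[n]$, and $\mathscr{G}_n(\sigma)$ is the subset of those avoiding the classical pattern $\sigma$. -}

module Defs where

open import Data.Nat using (ℕ; zero; suc; _+_; _<ᵇ_)
open import Data.Bool using (Bool; true; false; _∧_; _∨_; not; if_then_else_)
open import Data.Fin using (Fin; toℕ)
open import Data.Vec using (Vec; []; _∷_; lookup)
open import Data.List using (List; []; _∷_; map; concatMap; filter; length; allFin)
open import Data.Bool.ListAction using (any; all)
open import Data.Bool.Properties using (T?)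

-- A permutation of [n] is represented in one-line notation as a vector
-- (π(1),...,π(n)) of elements of Fin n with pairwise distinct entries.

allVecs : (n m : ℕ) → List (Vec (Fin n) m)
allVecs n zero = [] ∷ []
allVecs n (suc m) = concatMap (λ x → map (x ∷_) (allVecs n m)) (allFin n)

_<ᶠ_ : {n : ℕ} → Fin n → Fin n → Bool
a <ᶠ b = toℕ a <ᵇ toℕ b

_==ᶠ_ : {n : ℕ} → Fin n → Fin n → Bool
a ==ᶠ b = not (a <ᶠ b) ∧ not (b <ᶠ a)

isPerm : {n : ℕ} → Vec (Fin n) n → Bool
isPerm {n} π = all (λ i → all (λ j → (i ==ᶠ j) ∨ not (lookup π i ==ᶠ lookup π j)) (allFin n)) (allFin n)

-- π has at most one descent: no two distinct positions i < j with
-- π(i) > π(i+1) and π(j) > π(j+1).  Descent at position i (0-based, i+1 < n).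
descentAt : {n : ℕ} → Vec (Fin n) n → Fin n → Fin n → Bool
descentAt π i i' = (toℕ i' Data.Nat.≡ᵇ suc (toℕ i)) ∧ (lookup π i' <ᶠ lookup π i)
  where open import Data.Nat using (_≡ᵇ_)

descents : {n : ℕ} → Vec (Fin n) n → ℕ
descents {n} π = length (filter (λ p → T? (descentAt π (Data.Product.proj₁ p) (Data.Product.proj₂ p)))
                   (concatMap (λ i → map (i Data.Product.,_) (allFin n)) (allFin n)))
  where import Data.Product

isGrassmannian : {n : ℕ} → Vec (Fin n) n → Bool
isGrassmannian π = descents π Data.Nat.≤ᵇ 1
  where open import Data.Nat using (_≤ᵇ_)

sameOrder : {n m : ℕ} → Fin n → Fin n → Fin m → Fin m → Bool
sameOrder a b c d = (a <ᶠ b) ∧ (c <ᶠ d) ∨ (b <ᶠ a) ∧ (d <ᶠ c)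

contains3 : {n : ℕ} → Vec (Fin n) n → Vec (Fin 3) 3 → Bool
contains3 {n} π σ =
  any (λ i → any (λ j → any (λ k →
    (i <ᶠ j) ∧ (j <ᶠ k)
    ∧ sameOrder (lookup π i) (lookup π j) (lookup σ (# 0)) (lookup σ (# 1))
    ∧ sameOrder (lookup π i) (lookup π k) (lookup σ (# 0)) (lookup σ (# 2))
    ∧ sameOrder (lookup π j) (lookup π k) (lookup σ (# 1)) (lookup σ (# 2)))
    (allFin n)) (allFin n)) (allFin n)
  where open import Data.Fin using (#_)

-- 𝒢_n(σ), as an explicit list (each element appears exactly once)
grassAvoiding : (n : ℕ) → Vec (Fin 3) 3 → List (Vec (Fin n) n)
grassAvoiding n σ =
  filter (λ π → T? (isPerm π ∧ isGrassmannian π ∧ not (contains3 π σ))) (allVecs n n)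

-- the patterns, 0-indexed: 132 ↦ [0,2,1] etc.
open import Data.Fin using (#_)
p132 p213 p231 p312 : Vec (Fin 3) 3
p132 = # 0 ∷ # 2 ∷ # 1 ∷ []
p213 = # 1 ∷ # 0 ∷ # 2 ∷ []
p231 = # 1 ∷ # 2 ∷ # 0 ∷ []
p312 = # 2 ∷ # 0 ∷ # 1 ∷ []

-- A Grassmannian permutation other than the identity has exactly one descent d, so it ascends on
-- [0, d] and on [d + 1, n). Because the second block ascends, each of its values is the least one
-- not used before, so the permutation is determined by its first block. Avoiding 132 forces the
-- first block to consist of consecutive values p, …, p + d with p ≥ 1; avoiding 231 forces it to be
-- 0, …, d - 1 followed by a value above d. Either way the permutation swaps two adjacent blocks of
-- positions, the second one starting at d + 1 and of some length w ≥ 1 with d + w < n; there are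
-- C(n, 2) such pairs (d, w), and the identity adds one. The patterns 213 and 312 are the reverse
-- complements of 132 and 231, and reverse complementation preserves Grassmannian permutations.

module Submission where

open import Defs
open import Data.Nat using (ℕ; _+_)
open import Data.Nat.Combinatorics using (_C_)
open import Data.Fin using (Fin)
open import Data.Vec using (Vec)
open import Data.List using (length)
open import Data.List.Membership.Propositional using (_∈_)
open import Data.List using (_∷_; [])
open import Relation.Binary.PropositionalEquality using (_≡_)

open import Data.Bool using (Bool; T; _∧_; _∨_; not)
open import Data.Bool.ListAction using (all; any)
open import Data.Bool.Properties using (T-∧; T-∨; T-≡; T-not-≡; ∧-identityʳ; ∧-zeroʳ; ∨-identityʳ)
open import Data.Empty using (⊥; ⊥-elim)
open import Data.Fin using (toℕ; fromℕ<; #_; punchOut)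
open import Data.Fin.Properties
  using (toℕ-injective; toℕ<n; toℕ-fromℕ<; fromℕ<-toℕ; fromℕ<-injective; punchOut-injective; injective⇒≤)
open import Data.List using (List; map; filter; allFin; concatMap; cartesianProductWith; upTo; _++_)
open import Data.List.Membership.Propositional.Properties
  using ( ∈-filter⁺; ∈-filter⁻; ∈-∃++; ∈-allFin; ∈-cartesianProductWith⁺; ∈-map⁺; ∈-map⁻
        ; ∈-++⁺ˡ; ∈-++⁺ʳ; ∈-++⁻; ∈-upTo⁺; ∈-upTo⁻)
open import Data.List.Properties using (length-map; length-++; length-upTo)
open import Data.List.Relation.Binary.Subset.Propositional using (_⊆_)
open import Data.List.Relation.Unary.All as All using (All; []; _∷_)
open import Data.List.Relation.Unary.All.Properties as AllP using (all⁺; all⁻)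
open import Data.List.Relation.Unary.Any using (here; there; satisfied)
open import Data.List.Relation.Unary.Any.Properties using (any⁺; any⁻)
open import Data.List.Membership.Propositional using (lose)
open import Data.List.Relation.Unary.AllPairs using ([]; _∷_)
open import Data.List.Relation.Unary.Unique.Propositional using (Unique)
import Data.List.Relation.Unary.Unique.Propositional.Properties as Unique
open import Data.Nat using (zero; suc; _∸_; _≤_; _<_; z≤n; s≤s; s≤s⁻¹; z<s; s<s; _≤?_; _<?_)
open import Data.Nat.Combinatorics using (nC1≡n; nCk+nC[k+1]≡[n+1]C[k+1])
open import Data.Nat.Properties
open import Data.Product using (∃; _×_; _,_; proj₁; proj₂; map₁)
open import Data.Sum as Sum using (_⊎_; inj₁; inj₂; [_,_]′)
open import Data.Vec as Vec using (lookup; tabulate)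
open import Data.Vec.Properties using (∷-injective; lookup∘tabulate; tabulate∘lookup; tabulate-cong)
open import Function.Base using (_∘′_; id)
open import Function.Bundles using (_⇔_; mk⇔; Equivalence)
open import Relation.Binary.PropositionalEquality
  using (refl; sym; trans; cong; cong₂; subst; subst₂; _≢_; module ≡-Reasoning)
open import Relation.Nullary using (¬_; yes; no; contradiction; _×-dec_)
open import Relation.Nullary.Decidable using (T?)
open import Relation.Unary using (Decidable)
open import Relation.Binary.Definitions using (tri<; tri≈; tri>)

open Equivalence using (to; from)

module _ {A : Set} where

  ∈-delete : ∀ (us : List A) {vs x z} → z ∈ us ++ x ∷ vs → z ≢ x → z ∈ us ++ vs
  ∈-delete []       (here z≡x) z≢x = contradiction z≡x z≢x
  ∈-delete []       (there z∈) _   = z∈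
  ∈-delete (u ∷ us) (here z≡u) _   = here z≡u
  ∈-delete (u ∷ us) (there z∈) z≢x = there (∈-delete us z∈ z≢x)

  length-insert : ∀ (us vs : List A) x → length (us ++ x ∷ vs) ≡ suc (length (us ++ vs))
  length-insert []       vs x = refl
  length-insert (u ∷ us) vs x = cong suc (length-insert us vs x)

  length-mono-⊆ : ∀ {xs ys : List A} → Unique xs → xs ⊆ ys → length xs ≤ length ys
  length-mono-⊆ {[]}     _            _     = z≤n
  length-mono-⊆ {x ∷ xs} (x∉xs ∷ xs!) xs⊆ys with ∈-∃++ (xs⊆ys (here refl))
  ... | us , vs , refl = ≤-trans (s≤s (length-mono-⊆ xs! xs⊆us++vs)) (≤-reflexive (sym (length-insert us vs x)))
    where
    xs⊆us++vs : xs ⊆ us ++ vs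
    xs⊆us++vs z∈xs = ∈-delete us (xs⊆ys (there z∈xs)) (λ z≡x → All.lookup x∉xs z∈xs (sym z≡x))

  map⁺-injectiveOn : ∀ {B : Set} {f : A → B} {xs} → Unique xs →
    (∀ {x y} → x ∈ xs → y ∈ xs → f x ≡ f y → x ≡ y) → Unique (map f xs)
  map⁺-injectiveOn {xs = []}     []          _   = []
  map⁺-injectiveOn {xs = x ∷ xs} (x∉xs ∷ xs!) inj =
    AllP.map⁺ (All.tabulate λ y∈xs fx≡fy → All.lookup x∉xs y∈xs (inj (here refl) (there y∈xs) fx≡fy))
    ∷ map⁺-injectiveOn xs! (λ x∈ y∈ → inj (there x∈) (there y∈))

  module _ {P : A → Set} (P? : Decidable P) where

    length-filter≤1 : ∀ {xs} → Unique xs → (∀ {x y} → x ∈ xs → y ∈ xs → P x → P y → x ≡ y) →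
                      length (filter P? xs) ≤ 1
    length-filter≤1 {xs} xs! P-unique with filter P? xs | Unique.filter⁺ P? xs! | (λ {z} → ∈-filter⁻ P? {z} {xs})
    ... | []     | _   | _   = z≤n
    ... | y ∷ ys | ys! | ∈⁻ = length-mono-⊆ {ys = y ∷ []} ys! λ z∈ →
      here (P-unique (proj₁ (∈⁻ z∈)) (proj₁ (∈⁻ (here refl))) (proj₂ (∈⁻ z∈)) (proj₂ (∈⁻ (here refl))))

    length-filter≤1⇒unique : ∀ {xs x y} → length (filter P? xs) ≤ 1 →
                             x ∈ xs → y ∈ xs → P x → P y → x ≡ y
    length-filter≤1⇒unique {xs} ≤1 x∈ y∈ Px Py =
      singleton (filter P? xs) ≤1 (∈-filter⁺ P? x∈ Px) (∈-filter⁺ P? y∈ Py)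
      where
      singleton : ∀ {x y} (zs : List A) → length zs ≤ 1 → x ∈ zs → y ∈ zs → x ≡ y
      singleton (z ∷ [])     _         (here refl) (here refl) = refl
      singleton (_ ∷ _ ∷ _)  (s≤s ())  _           _

concatMap-map≡cartesianProductWith : ∀ {A B C : Set} (f : A → B → C) xs ys →
  concatMap (λ x → map (f x) ys) xs ≡ cartesianProductWith f xs ys
concatMap-map≡cartesianProductWith f []       ys = refl
concatMap-map≡cartesianProductWith f (x ∷ xs) ys =
  cong (map (f x) ys ++_) (concatMap-map≡cartesianProductWith f xs ys)

allVecs-complete : ∀ n m (v : Vec (Fin n) m) → v ∈ allVecs n m
allVecs-complete n zero    Vec.[]        = here refl
allVecs-complete n (suc m) (x Vec.∷ v) =
  subst (x Vec.∷ v ∈_) (sym (concatMap-map≡cartesianProductWith Vec._∷_ (allFin n) (allVecs n m)))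
    (∈-cartesianProductWith⁺ Vec._∷_ (∈-allFin x) (allVecs-complete n m v))

allVecs-unique : ∀ n m → Unique (allVecs n m)
allVecs-unique n zero    = [] ∷ []
allVecs-unique n (suc m) =
  subst Unique (sym (concatMap-map≡cartesianProductWith Vec._∷_ (allFin n) (allVecs n m)))
    (Unique.cartesianProductWith⁺ Vec._∷_ ∷-injective (Unique.allFin⁺ n) (allVecs-unique n m))

T-not : ∀ {x} → T (not x) ⇔ (¬ T x)
T-not {Bool.true}  = mk⇔ (λ ()) (λ ¬t → ¬t _)
T-not {Bool.false} = mk⇔ (λ _ ()) (λ _ → _)

T-all-allFin : ∀ {n} (p : Fin n → Bool) → T (all p (allFin n)) ⇔ (∀ i → T (p i))
T-all-allFin {n} p = mk⇔ (λ t i → All.lookup (all⁺ p (allFin n) t) (∈-allFin i))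
                         (λ ∀p → all⁻ p {allFin n} (All.tabulate λ {i} _ → ∀p i))

T-any-allFin : ∀ {n} (p : Fin n → Bool) → T (any p (allFin n)) ⇔ (∃ λ i → T (p i))
T-any-allFin {n} p = mk⇔ (λ t → satisfied (any⁻ p (allFin n) t))
                         (λ (i , pi) → any⁺ p (lose (∈-allFin i) pi))

<ᶠ⇔< : ∀ {n} {a b : Fin n} → T (a <ᶠ b) ⇔ toℕ a < toℕ b
<ᶠ⇔< {a = a} {b} = mk⇔ (<ᵇ⇒< (toℕ a) (toℕ b)) <⇒<ᵇ

==ᶠ⇔≡ : ∀ {n} {a b : Fin n} → T (a ==ᶠ b) ⇔ toℕ a ≡ toℕ b
==ᶠ⇔≡ = mk⇔
  (λ t → let a≮b , b≮a = to T-∧ t in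
    ≤-antisym (≮⇒≥ (to T-not b≮a ∘′ from <ᶠ⇔<)) (≮⇒≥ (to T-not a≮b ∘′ from <ᶠ⇔<)))
  (λ a≡b → from T-∧ (from T-not (λ t → <-irrefl a≡b (to <ᶠ⇔< t)) ,
                     from T-not (λ t → <-irrefl (sym a≡b) (to <ᶠ⇔< t))))

∀Fin⇒∀< : ∀ {n} {P : ℕ → Set} → (∀ (a : Fin n) → P (toℕ a)) → ∀ {i} → i < n → P i
∀Fin⇒∀< {P = P} ∀a {i} i<n = subst P (toℕ-fromℕ< i<n) (∀a (fromℕ< i<n))

T-∨-not⇒ : ∀ {x y} → T (x ∨ not y) → T y → T x
T-∨-not⇒ {y = y} t ty with to T-∨ t
... | inj₁ tx  = tx
... | inj₂ t¬y = contradiction ty (to T-not t¬y)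

⇒T-∨-not : ∀ {x y} → (T y → T x) → T (x ∨ not y)
⇒T-∨-not {x} {Bool.true}  ty⇒tx = from (T-∨ {x}) (inj₁ (ty⇒tx _))
⇒T-∨-not {x} {Bool.false} _     = from (T-∨ {x}) (inj₂ _)

-- Permutations of [n] as maps on ℕ

Agree : ℕ → (ℕ → ℕ) → (ℕ → ℕ) → Set
Agree n f g = ∀ {i} → i < n → f i ≡ g i

MapsInto : ℕ → (ℕ → ℕ) → Set
MapsInto n g = ∀ {i} → i < n → g i < n

InjectiveOn : ℕ → (ℕ → ℕ) → Set
InjectiveOn n g = ∀ {i j} → i < n → j < n → g i ≡ g j → i ≡ j

Descent : (ℕ → ℕ) → ℕ → Set
Descent g i = g (suc i) < g i

AtMostOneDescent : ℕ → (ℕ → ℕ) → Set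
AtMostOneDescent n g = ∀ {i j} → suc i < n → suc j < n → Descent g i → Descent g j → i ≡ j

Pattern : Set₁
Pattern = ℕ → ℕ → ℕ → Set

resp₃ : ∀ (R : Pattern) {x x′ y y′ z z′} → x ≡ x′ → y ≡ y′ → z ≡ z′ → R x y z → R x′ y′ z′
resp₃ R refl refl refl r = r

Avoids : ℕ → Pattern → (ℕ → ℕ) → Set
Avoids n R g = ∀ {i j k} → i < j → j < k → k < n → ¬ R (g i) (g j) (g k)

record GrassmannianAvoider (n : ℕ) (R : Pattern) (g : ℕ → ℕ) : Set where
  field
    mapsInto         : MapsInto n g
    injective        : InjectiveOn n g
    atMostOneDescent : AtMostOneDescent n g
    avoids           : Avoids n R g

GrassmannianAvoider-resp : ∀ {n R f g} → Agree n f g → GrassmannianAvoider n R f → GrassmannianAvoider n R g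
GrassmannianAvoider-resp {n} {R} {f} {g} f≗g ga = record
  { mapsInto         = λ i<n → subst (_< n) (f≗g i<n) (mapsInto i<n)
  ; injective        = λ i<n j<n gi≡gj → injective i<n j<n (trans (f≗g i<n) (trans gi≡gj (sym (f≗g j<n))))
  ; atMostOneDescent = λ si<n sj<n di dj → atMostOneDescent si<n sj<n (descent si<n di) (descent sj<n dj)
  ; avoids           = λ i<j j<k k<n r → avoids i<j j<k k<n
                         (let j<n = <-trans j<k k<n in
                          resp₃ R (sym (f≗g (<-trans i<j j<n))) (sym (f≗g j<n)) (sym (f≗g k<n)) r)
  }
  where
  open GrassmannianAvoider ga
  descent : ∀ {i} → suc i < n → Descent g i → Descent f i
  descent {i} si<n = subst₂ _<_ (sym (f≗g si<n)) (sym (f≗g (<-trans (n<1+n i) si<n)))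

identity-grassmannianAvoider : ∀ {n R} → (∀ {i j k} → i < j → j < k → ¬ R i j k) → GrassmannianAvoider n R id
identity-grassmannianAvoider identity-avoids = record
  { mapsInto         = id
  ; injective        = λ _ _ i≡j → i≡j
  ; atMostOneDescent = λ {i} _ _ di _ → contradiction (n<1+n i) (<-asym di)
  ; avoids           = λ i<j j<k _ → identity-avoids i<j j<k
  }

-- The junk value 0 outside [n] is never used.
⟦_⟧ : ∀ {n} → Vec (Fin n) n → ℕ → ℕ
⟦_⟧ {n} π i with i <? n
... | yes i<n = toℕ (lookup π (fromℕ< i<n))
... | no  _   = 0

⟦⟧-fromℕ< : ∀ {n} (π : Vec (Fin n) n) {i} (i<n : i < n) → ⟦ π ⟧ i ≡ toℕ (lookup π (fromℕ< i<n))
⟦⟧-fromℕ< {n} π {i} i<n with i <? n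
... | yes _   = refl
... | no  i≮n = contradiction i<n i≮n

⟦⟧-lookup : ∀ {n} (π : Vec (Fin n) n) (a : Fin n) → ⟦ π ⟧ (toℕ a) ≡ toℕ (lookup π a)
⟦⟧-lookup π a = trans (⟦⟧-fromℕ< π (toℕ<n a)) (cong (λ b → toℕ (lookup π b)) (fromℕ<-toℕ a _))

⟦⟧-mapsInto : ∀ {n} (π : Vec (Fin n) n) → MapsInto n ⟦ π ⟧
⟦⟧-mapsInto π i<n = subst (_< _) (sym (⟦⟧-fromℕ< π i<n)) (toℕ<n _)

⟦⟧-injective : ∀ {n} {π ρ : Vec (Fin n) n} → Agree n ⟦ π ⟧ ⟦ ρ ⟧ → π ≡ ρ
⟦⟧-injective {π = π} {ρ} π≗ρ = begin
  π                     ≡⟨ tabulate∘lookup π ⟨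
  tabulate (lookup π)   ≡⟨ tabulate-cong (λ a → toℕ-injective (begin
                             toℕ (lookup π a) ≡⟨ ⟦⟧-lookup π a ⟨
                             ⟦ π ⟧ (toℕ a)    ≡⟨ π≗ρ (toℕ<n a) ⟩
                             ⟦ ρ ⟧ (toℕ a)    ≡⟨ ⟦⟧-lookup ρ a ⟩
                             toℕ (lookup ρ a) ∎)) ⟩
  tabulate (lookup ρ)   ≡⟨ tabulate∘lookup ρ ⟩
  ρ                     ∎
  where open ≡-Reasoning

-- Out-of-range values are replaced by the default, an arbitrary choice.
toFin : ∀ {n} → Fin n → ℕ → Fin n
toFin {n} default v with v <? n
... | yes v<n = fromℕ< v<n
... | no  _   = default

toℕ-toFin : ∀ {n} (default : Fin n) {v} → v < n → toℕ (toFin default v) ≡ v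
toℕ-toFin {n} default {v} v<n with v <? n
... | yes _   = toℕ-fromℕ< v<n
... | no  v≮n = contradiction v<n v≮n

fromFun : (n : ℕ) → (ℕ → ℕ) → Vec (Fin n) n
fromFun n f = tabulate λ a → toFin a (f (toℕ a))

⟦fromFun⟧ : ∀ {n f} → MapsInto n f → Agree n ⟦ fromFun n f ⟧ f
⟦fromFun⟧ {n} {f} f∈ {i} i<n = begin
  ⟦ fromFun n f ⟧ i                 ≡⟨ ⟦⟧-fromℕ< (fromFun n f) i<n ⟩
  toℕ (lookup (fromFun n f) a)      ≡⟨ cong toℕ (lookup∘tabulate (λ b → toFin b (f (toℕ b))) a) ⟩
  toℕ (toFin a (f (toℕ a)))         ≡⟨ toℕ-toFin a (subst (λ j → f j < n) (sym toℕa≡i) (f∈ i<n)) ⟩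
  f (toℕ a)                         ≡⟨ cong f toℕa≡i ⟩
  f i                               ∎
  where
  open ≡-Reasoning
  a : Fin n
  a = fromℕ< i<n
  toℕa≡i : toℕ a ≡ i
  toℕa≡i = toℕ-fromℕ< i<n

fromFun-injective : ∀ {n f g} → MapsInto n f → MapsInto n g → fromFun n f ≡ fromFun n g → Agree n f g
fromFun-injective f∈ g∈ e {i} i<n =
  trans (sym (⟦fromFun⟧ f∈ i<n)) (trans (cong (λ π → ⟦ π ⟧ i) e) (⟦fromFun⟧ g∈ i<n))

≡fromFun : ∀ {n f} {π : Vec (Fin n) n} → MapsInto n f → Agree n ⟦ π ⟧ f → π ≡ fromFun n f
≡fromFun f∈ π≗f = ⟦⟧-injective (λ i<n → trans (π≗f i<n) (sym (⟦fromFun⟧ f∈ i<n)))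

orderIsomorphic : ∀ {m} → Vec (Fin 3) 3 → Fin m → Fin m → Fin m → Bool
orderIsomorphic σ a b c =
  sameOrder a b (lookup σ (# 0)) (lookup σ (# 1)) ∧
  sameOrder a c (lookup σ (# 0)) (lookup σ (# 2)) ∧
  sameOrder b c (lookup σ (# 1)) (lookup σ (# 2))

Realizes : Vec (Fin 3) 3 → Pattern → Set
Realizes σ R = ∀ {m} (a b c : Fin m) → T (orderIsomorphic σ a b c) ⇔ R (toℕ a) (toℕ b) (toℕ c)

module _ {n : ℕ} (π : Vec (Fin n) n) where

  private
    π⟨_⟩ : Fin n → ℕ
    π⟨ a ⟩ = toℕ (lookup π a)

    ⟦⟧-≡⇔ : ∀ a b → ⟦ π ⟧ (toℕ a) ≡ ⟦ π ⟧ (toℕ b) ⇔ π⟨ a ⟩ ≡ π⟨ b ⟩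
    ⟦⟧-≡⇔ a b = mk⇔ (λ e → trans (sym (⟦⟧-lookup π a)) (trans e (⟦⟧-lookup π b)))
                    (λ e → trans (⟦⟧-lookup π a) (trans e (sym (⟦⟧-lookup π b))))

  isPerm⇔ : T (isPerm π) ⇔ InjectiveOn n ⟦ π ⟧
  isPerm⇔ = mk⇔
    (λ t {i} {j} i<n j<n →
      ∀Fin⇒∀< {P = λ i → ∀ {j} → j < n → ⟦ π ⟧ i ≡ ⟦ π ⟧ j → i ≡ j}
        (λ a → ∀Fin⇒∀< {P = λ j → ⟦ π ⟧ (toℕ a) ≡ ⟦ π ⟧ j → toℕ a ≡ j} λ b e →
          to ==ᶠ⇔≡ (T-∨-not⇒ (to (T-all-allFin _) (to (T-all-allFin _) t a) b)
                             (from ==ᶠ⇔≡ (to (⟦⟧-≡⇔ a b) e))))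
        i<n j<n)
    (λ inj → from (T-all-allFin _) λ a → from (T-all-allFin _) λ b → ⇒T-∨-not λ t →
      from ==ᶠ⇔≡ (inj (toℕ<n a) (toℕ<n b) (from (⟦⟧-≡⇔ a b) (to ==ᶠ⇔≡ t))))

  private
    descentPairs : List (Fin n × Fin n)
    descentPairs = concatMap (λ a → map (a ,_) (allFin n)) (allFin n)

    ∈-descentPairs : ∀ a b → (a , b) ∈ descentPairs
    ∈-descentPairs a b = subst ((a , b) ∈_) (sym (concatMap-map≡cartesianProductWith _,_ (allFin n) (allFin n)))
                           (∈-cartesianProductWith⁺ _,_ (∈-allFin a) (∈-allFin b))

    descentPairs-unique : Unique descentPairs
    descentPairs-unique = subst Unique (sym (concatMap-map≡cartesianProductWith _,_ (allFin n) (allFin n)))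
      (Unique.cartesianProductWith⁺ _,_ (λ { refl → refl , refl }) (Unique.allFin⁺ n) (Unique.allFin⁺ n))

    IsDescentPair : Fin n × Fin n → Set
    IsDescentPair (a , b) = T (descentAt π a b)

    descentAt⇔ : ∀ a b → T (descentAt π a b) ⇔ (toℕ b ≡ suc (toℕ a) × Descent ⟦ π ⟧ (toℕ a))
    descentAt⇔ a b = mk⇔
      (λ t → let b≡sa , πb<πa = to T-∧ t ; b≡sa′ = ≡ᵇ⇒≡ (toℕ b) (suc (toℕ a)) b≡sa in
        b≡sa′ , subst₂ _<_ (trans (sym (⟦⟧-lookup π b)) (cong ⟦ π ⟧ b≡sa′)) (sym (⟦⟧-lookup π a)) (to <ᶠ⇔< πb<πa))
      (λ (b≡sa , desc) → from T-∧ (≡⇒≡ᵇ (toℕ b) (suc (toℕ a)) b≡sa ,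
        from <ᶠ⇔< (subst₂ _<_ (trans (cong ⟦ π ⟧ (sym b≡sa)) (⟦⟧-lookup π b)) (⟦⟧-lookup π a) desc)))

  isGrassmannian⇔ : T (isGrassmannian π) ⇔ AtMostOneDescent n ⟦ π ⟧
  isGrassmannian⇔ = mk⇔
    (λ t {i} {j} si<n sj<n di dj →
      let pair≡ = length-filter≤1⇒unique P? (≤ᵇ⇒≤ (descents π) 1 t)
                    (∈-descentPairs _ _) (∈-descentPairs _ _) (pair si<n di) (pair sj<n dj)
      in trans (sym (toℕ-fromℕ< (<-trans (n<1+n i) si<n)))
               (trans (cong (toℕ ∘′ proj₁) pair≡) (toℕ-fromℕ< (<-trans (n<1+n j) sj<n))))
    (λ one → ≤⇒≤ᵇ (length-filter≤1 P? descentPairs-unique λ {(a , a′)} {(b , b′)} _ _ pa pb →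
      let a′≡sa , da = to (descentAt⇔ a a′) pa ; b′≡sb , db = to (descentAt⇔ b b′) pb
          a≡b = one (subst (_< n) a′≡sa (toℕ<n a′)) (subst (_< n) b′≡sb (toℕ<n b′)) da db
      in cong₂ _,_ (toℕ-injective a≡b) (toℕ-injective (trans a′≡sa (trans (cong suc a≡b) (sym b′≡sb))))))
    where
    P? : Decidable IsDescentPair
    P? p = T? (descentAt π (proj₁ p) (proj₂ p))
    pair : ∀ {i} (si<n : suc i < n) → Descent ⟦ π ⟧ i →
           IsDescentPair (fromℕ< (<-trans (n<1+n i) si<n) , fromℕ< si<n)
    pair {i} si<n di = from (descentAt⇔ _ _)
      ( trans (toℕ-fromℕ< si<n) (cong suc (sym (toℕ-fromℕ< (<-trans (n<1+n i) si<n))))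
      , subst (Descent ⟦ π ⟧) (sym (toℕ-fromℕ< (<-trans (n<1+n i) si<n))) di)

  private
    Occurrence : Vec (Fin 3) 3 → Set
    Occurrence σ = ∃ λ a → ∃ λ b → ∃ λ c →
      T ((a <ᶠ b) ∧ (b <ᶠ c) ∧ orderIsomorphic σ (lookup π a) (lookup π b) (lookup π c))

    contains3⇔ : ∀ σ → T (contains3 π σ) ⇔ Occurrence σ
    contains3⇔ σ = mk⇔
      (λ t → let a , ta = to (T-any-allFin _) t ; b , tb = to (T-any-allFin _) ta
                 c , tc = to (T-any-allFin _) tb in a , b , c , tc)
      (λ (a , b , c , t) → from (T-any-allFin _) (a , from (T-any-allFin _) (b , from (T-any-allFin _) (c , t))))

  avoids⇔ : ∀ {σ R} → Realizes σ R → (¬ T (contains3 π σ)) ⇔ Avoids n R ⟦ π ⟧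
  avoids⇔ {σ} {R} σ∼R = mk⇔
    (λ ¬t {i} {j} {k} i<j j<k k<n r →
      let j<n = <-trans j<k k<n ; i<n = <-trans i<j j<n in
      ¬t (from (contains3⇔ σ) (fromℕ< i<n , fromℕ< j<n , fromℕ< k<n , from T-∧
        ( from <ᶠ⇔< (subst₂ _<_ (sym (toℕ-fromℕ< i<n)) (sym (toℕ-fromℕ< j<n)) i<j)
        , from T-∧ ( from <ᶠ⇔< (subst₂ _<_ (sym (toℕ-fromℕ< j<n)) (sym (toℕ-fromℕ< k<n)) j<k)
                   , from (σ∼R _ _ _) (resp₃ R (⟦⟧-fromℕ< π i<n) (⟦⟧-fromℕ< π j<n) (⟦⟧-fromℕ< π k<n) r))))))
    (λ avoid t →
      let a , b , c , t′ = to (contains3⇔ σ) t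
          a<b , rest = to T-∧ t′
          b<c , iso = to T-∧ rest
      in avoid (to <ᶠ⇔< a<b) (to <ᶠ⇔< b<c) (toℕ<n c)
           (resp₃ R (sym (⟦⟧-lookup π a)) (sym (⟦⟧-lookup π b)) (sym (⟦⟧-lookup π c)) (to (σ∼R _ _ _) iso)))

module Characterisation (σ : Vec (Fin 3) 3) (R : Pattern) (σ∼R : Realizes σ R) {n : ℕ} where

  private
    IsMember : Vec (Fin n) n → Bool
    IsMember π = isPerm π ∧ isGrassmannian π ∧ not (contains3 π σ)

  grassAvoiding-unique : Unique (grassAvoiding n σ)
  grassAvoiding-unique = Unique.filter⁺ (λ π → T? (IsMember π)) (allVecs-unique n n)

  ∈-grassAvoiding⇔ : ∀ {π} → π ∈ grassAvoiding n σ ⇔ GrassmannianAvoider n R ⟦ π ⟧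
  ∈-grassAvoiding⇔ {π} = mk⇔
    (λ π∈ → let perm , rest = to T-∧ (proj₂ (∈-filter⁻ (λ π → T? (IsMember π)) {xs = allVecs n n} π∈))
                grass , avoid = to T-∧ rest
            in record { mapsInto         = ⟦⟧-mapsInto π
                      ; injective        = to (isPerm⇔ π) perm
                      ; atMostOneDescent = to (isGrassmannian⇔ π) grass
                      ; avoids           = to (avoids⇔ π {σ} {R} σ∼R) (to T-not avoid) })
    (λ ga → ∈-filter⁺ (λ π → T? (IsMember π)) (allVecs-complete n n π)
      (from T-∧ ( from (isPerm⇔ π) (GrassmannianAvoider.injective ga)
                , from T-∧ ( from (isGrassmannian⇔ π) (GrassmannianAvoider.atMostOneDescent ga)
                           , from T-not (from (avoids⇔ π {σ} {R} σ∼R) (GrassmannianAvoider.avoids ga))))))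

Is132 Is213 Is231 Is312 : Pattern
Is132 x y z = x < z × z < y
Is213 x y z = y < x × x < z
Is231 x y z = z < x × x < y
Is312 x y z = y < z × z < x

module _ {m : ℕ} {a b : Fin m} (x y : Fin 3) where

  sameOrder-ascending : toℕ x < toℕ y → T (sameOrder a b x y) ⇔ toℕ a < toℕ b
  sameOrder-ascending x<y
    rewrite to T-≡ (from (<ᶠ⇔< {a = x} {y}) x<y)
          | to T-not-≡ (from T-not (λ t → <-asym x<y (to (<ᶠ⇔< {a = y} {x}) t)))
          | ∧-identityʳ (a <ᶠ b) | ∧-zeroʳ (b <ᶠ a) | ∨-identityʳ (a <ᶠ b) = <ᶠ⇔<

  sameOrder-descending : toℕ y < toℕ x → T (sameOrder a b x y) ⇔ toℕ b < toℕ a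
  sameOrder-descending y<x
    rewrite to T-not-≡ (from T-not (λ t → <-asym y<x (to (<ᶠ⇔< {a = x} {y}) t)))
          | to T-≡ (from (<ᶠ⇔< {a = y} {x}) y<x)
          | ∧-zeroʳ (a <ᶠ b) | ∧-identityʳ (b <ᶠ a) = <ᶠ⇔<

orderIsomorphic⇔ : ∀ {m} σ (a b c : Fin m) → T (orderIsomorphic σ a b c) ⇔
  (T (sameOrder a b (lookup σ (# 0)) (lookup σ (# 1))) ×
   T (sameOrder a c (lookup σ (# 0)) (lookup σ (# 2))) ×
   T (sameOrder b c (lookup σ (# 1)) (lookup σ (# 2))))
orderIsomorphic⇔ σ a b c = mk⇔
  (λ t → let t₁ , t₂₃ = to (T-∧ {sameOrder a b (lookup σ (# 0)) (lookup σ (# 1))}) t in t₁ , to T-∧ t₂₃)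
  (λ (t₁ , t₂ , t₃) → from T-∧ (t₁ , from T-∧ (t₂ , t₃)))

realizes132 : Realizes p132 Is132
realizes132 a b c = mk⇔
  (λ t → let _ , a<c , c<b = to (orderIsomorphic⇔ p132 a b c) t in
    to (sameOrder-ascending (# 0) (# 1) z<s) a<c , to (sameOrder-descending (# 2) (# 1) (s<s z<s)) c<b)
  (λ (a<c , c<b) → from (orderIsomorphic⇔ p132 a b c)
    ( from (sameOrder-ascending (# 0) (# 2) z<s) (<-trans a<c c<b)
    , from (sameOrder-ascending (# 0) (# 1) z<s) a<c
    , from (sameOrder-descending (# 2) (# 1) (s<s z<s)) c<b))

realizes213 : Realizes p213 Is213
realizes213 a b c = mk⇔
  (λ t → let b<a , a<c , _ = to (orderIsomorphic⇔ p213 a b c) t in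
    to (sameOrder-descending (# 1) (# 0) z<s) b<a , to (sameOrder-ascending (# 1) (# 2) (s<s z<s)) a<c)
  (λ (b<a , a<c) → from (orderIsomorphic⇔ p213 a b c)
    ( from (sameOrder-descending (# 1) (# 0) z<s) b<a
    , from (sameOrder-ascending (# 1) (# 2) (s<s z<s)) a<c
    , from (sameOrder-ascending (# 0) (# 2) z<s) (<-trans b<a a<c)))

realizes231 : Realizes p231 Is231
realizes231 a b c = mk⇔
  (λ t → let a<b , c<a , _ = to (orderIsomorphic⇔ p231 a b c) t in
    to (sameOrder-descending (# 1) (# 0) z<s) c<a , to (sameOrder-ascending (# 1) (# 2) (s<s z<s)) a<b)
  (λ (c<a , a<b) → from (orderIsomorphic⇔ p231 a b c)
    ( from (sameOrder-ascending (# 1) (# 2) (s<s z<s)) a<b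
    , from (sameOrder-descending (# 1) (# 0) z<s) c<a
    , from (sameOrder-descending (# 2) (# 0) z<s) (<-trans c<a a<b)))

realizes312 : Realizes p312 Is312
realizes312 a b c = mk⇔
  (λ t → let _ , c<a , b<c = to (orderIsomorphic⇔ p312 a b c) t in
    to (sameOrder-ascending (# 0) (# 1) z<s) b<c , to (sameOrder-descending (# 2) (# 1) (s<s z<s)) c<a)
  (λ (b<c , c<a) → from (orderIsomorphic⇔ p312 a b c)
    ( from (sameOrder-descending (# 2) (# 0) z<s) (<-trans b<c c<a)
    , from (sameOrder-descending (# 2) (# 1) (s<s z<s)) c<a
    , from (sameOrder-ascending (# 0) (# 1) z<s) b<c))

-- Ascending blocks

AscendingOn : (ℕ → ℕ) → ℕ → ℕ → Set
AscendingOn g a b = ∀ {i} → a ≤ i → suc i < b → g i < g (suc i)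

module _ {g : ℕ → ℕ} {a b : ℕ} (asc : AscendingOn g a b) where

  ascending-< : ∀ {i j} → a ≤ i → i < j → j < b → g i < g j
  ascending-< {i} {suc j} a≤i i<sj sj<b with m≤n⇒m<n∨m≡n (s≤s⁻¹ i<sj)
  ... | inj₁ i<j  = <-trans (ascending-< a≤i i<j (<-trans (n<1+n j) sj<b)) (asc (≤-trans a≤i (<⇒≤ i<j)) sj<b)
  ... | inj₂ refl = asc a≤i sj<b

  ascending-≤ : ∀ {i j} → a ≤ i → i ≤ j → j < b → g i ≤ g j
  ascending-≤ a≤i i≤j j<b with m≤n⇒m<n∨m≡n i≤j
  ... | inj₁ i<j  = <⇒≤ (ascending-< a≤i i<j j<b)
  ... | inj₂ refl = ≤-refl

module TwoBlocks {n d : ℕ} {g : ℕ → ℕ} (asc₁ : AscendingOn g 0 (suc d)) (asc₂ : AscendingOn g (suc d) n) where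

  inversion-straddles : ∀ {i j} → i < j → j < n → g j < g i → i ≤ d × d < j
  inversion-straddles {i} {j} i<j j<n gj<gi with j ≤? d | i ≤? d
  ... | yes j≤d | _       = contradiction (ascending-< asc₁ z≤n i<j (s≤s j≤d)) (<-asym gj<gi)
  ... | no  j≰d | yes i≤d = i≤d , ≰⇒> j≰d
  ... | no  _   | no  i≰d = contradiction (ascending-< asc₂ (≰⇒> i≰d) i<j j<n) (<-asym gj<gi)

  descent⇒≡ : ∀ {i} → suc i < n → Descent g i → i ≡ d
  descent⇒≡ {i} si<n desc = let i≤d , d<si = inversion-straddles (n<1+n i) si<n desc in ≤-antisym i≤d (s≤s⁻¹ d<si)

  atMostOneDescent : AtMostOneDescent n g
  atMostOneDescent si<n sj<n di dj = trans (descent⇒≡ si<n di) (sym (descent⇒≡ sj<n dj))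

  module _ (separated : ∀ {i j} → i ≤ d → d < j → j < n → g i ≢ g j) where

    distinct : ∀ {i j} → i < j → j < n → g i ≢ g j
    distinct {i} {j} i<j j<n gi≡gj with j ≤? d | i ≤? d
    ... | yes j≤d | _       = <-irrefl gi≡gj (ascending-< asc₁ z≤n i<j (s≤s j≤d))
    ... | no  j≰d | yes i≤d = separated i≤d (≰⇒> j≰d) j<n gi≡gj
    ... | no  _   | no  i≰d = <-irrefl gi≡gj (ascending-< asc₂ (≰⇒> i≰d) i<j j<n)

    injective : InjectiveOn n g
    injective {i} {j} i<n j<n gi≡gj with <-cmp i j
    ... | tri< i<j _ _ = contradiction gi≡gj (distinct i<j j<n)
    ... | tri≈ _ i≡j _ = i≡j
    ... | tri> _ _ j<i = contradiction (sym gi≡gj) (distinct j<i i<n)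

-- Pigeonhole: an injection of [n] avoiding the value v would inject Fin n into Fin (n - 1).
injective-missing-value : ∀ {n v g} → MapsInto n g → InjectiveOn n g → v < n → (∀ {i} → i < n → g i ≢ v) → ⊥
injective-missing-value {suc m} {v} {g} g∈ g-inj v<n missing = <-irrefl refl (injective⇒≤ squeeze-injective)
  where
  value : Fin (suc m) → Fin (suc m)
  value a = fromℕ< (g∈ (toℕ<n a))

  skip : ∀ a → fromℕ< v<n ≢ value a
  skip a e = missing (toℕ<n a) (sym (fromℕ<-injective _ _ v<n (g∈ (toℕ<n a)) e))

  squeeze : Fin (suc m) → Fin m
  squeeze a = punchOut (skip a)

  squeeze-injective : ∀ {a b} → squeeze a ≡ squeeze b → a ≡ b
  squeeze-injective {a} {b} e = toℕ-injective (g-inj (toℕ<n a) (toℕ<n b)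
    (fromℕ<-injective _ _ (g∈ (toℕ<n a)) (g∈ (toℕ<n b)) (punchOut-injective (skip a) (skip b) e)))

module Permutation {n : ℕ} {g : ℕ → ℕ} (g∈ : MapsInto n g) (g-inj : InjectiveOn n g) where

  surjective : ∀ {v} → v < n → ∃ λ i → i < n × g i ≡ v
  surjective {v} v<n with anyUpTo? (λ i → g i ≟ v) n
  ... | yes found = found
  ... | no  ∄     = ⊥-elim (injective-missing-value g∈ g-inj v<n λ i<n gi≡v → ∄ (_ , i<n , gi≡v))

  ascent-or-descent : ∀ {i} → suc i < n → g i < g (suc i) ⊎ Descent g i
  ascent-or-descent {i} si<n with <-cmp (g i) (g (suc i))
  ... | tri< gi<gsi _ _ = inj₁ gi<gsi
  ... | tri≈ _ gi≡gsi _ = contradiction (g-inj (<-trans (n<1+n i) si<n) si<n gi≡gsi) (<⇒≢ (n<1+n i))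
  ... | tri> _ _ gsi<gi = inj₂ gsi<gi

  ascending-or-descent : AscendingOn g 0 n ⊎ ∃ λ d → suc d < n × Descent g d
  ascending-or-descent with anyUpTo? (λ d → suc d <? n ×-dec g (suc d) <? g d) n
  ... | yes (d , _ , sd<n , desc) = inj₂ (d , sd<n , desc)
  ... | no  ∄ = inj₁ λ {i} _ si<n → [ id , (λ di → ⊥-elim (∄ (i , <-trans (n<1+n i) si<n , si<n , di))) ]′
                                      (ascent-or-descent si<n)

  ascending-blocks : AtMostOneDescent n g → ∀ {d} → suc d < n → Descent g d →
                     AscendingOn g 0 (suc d) × AscendingOn g (suc d) n
  ascending-blocks one {d} sd<n dd =
    (λ _ si<sd → ascent (<-trans si<sd sd<n) (λ i≡d → <-irrefl i≡d (s≤s⁻¹ si<sd))) ,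
    (λ sd≤i si<n → ascent si<n (λ i≡d → <-irrefl (sym i≡d) sd≤i))
    where
    ascent : ∀ {i} → suc i < n → i ≢ d → g i < g (suc i)
    ascent si<n i≢d with ascent-or-descent si<n
    ... | inj₁ up = up
    ... | inj₂ di = contradiction (one si<n sd<n di dd) i≢d

  fixed-prefix⇒no-descent : ∀ {d} → suc d < n → (∀ {i} → i ≤ d → g i ≡ i) → ¬ Descent g d
  fixed-prefix⇒no-descent {d} sd<n fixed dd = <-irrefl gsd≡sd (<-trans gsd<d (n<1+n d))
    where
    gsd<d : g (suc d) < d
    gsd<d = subst (g (suc d) <_) (fixed ≤-refl) dd
    gsd≡sd : g (suc d) ≡ suc d
    gsd≡sd = g-inj (<-trans gsd<d (<-trans (n<1+n d) sd<n)) sd<n (fixed (<⇒≤ gsd<d))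

  left-minima⇒fixed : ∀ {c} → c ≤ n → (∀ {i j} → i < c → i < j → j < n → g i < g j) → Agree c g id
  left-minima⇒fixed {c} c≤n minima i<c = fixed-below c ≤-refl i<c
    where
    next-fixed : ∀ {k} → k < c → k < n → Agree k g id → g k ≡ k
    next-fixed {k} k<c k<n prefix with <-cmp (g k) k
    ... | tri< gk<k _ _ = contradiction (g-inj (<-trans gk<k k<n) k<n (prefix gk<k)) (<⇒≢ gk<k)
    ... | tri≈ _ gk≡k _ = gk≡k
    ... | tri> _ _ k<gk with surjective k<n
    ...   | j , j<n , gj≡k with <-cmp j k
    ...     | tri< j<k _ _  = contradiction (trans (sym (prefix j<k)) gj≡k) (<⇒≢ j<k)
    ...     | tri≈ _ refl _ = contradiction gj≡k (>⇒≢ k<gk)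
    ...     | tri> _ _ k<j  = contradiction (subst (g k <_) gj≡k (minima k<c k<j j<n)) (<-asym k<gk)

    fixed-below : ∀ k → k ≤ c → Agree k g id
    fixed-below (suc k) sk≤c i<sk with m≤n⇒m<n∨m≡n (s≤s⁻¹ i<sk)
    ... | inj₁ i<k  = fixed-below k (<⇒≤ sk≤c) i<k
    ... | inj₂ refl = next-fixed sk≤c (<-≤-trans sk≤c c≤n) (fixed-below k (<⇒≤ sk≤c))

-- The value at k ≥ c is forced to be the least value not taken below k.
agreeing-prefix⇒≮ : ∀ {n c g h} → InjectiveOn n g → MapsInto n h → InjectiveOn n h → AscendingOn h c n →
                    ∀ {k} → c ≤ k → k < n → Agree k g h → ¬ g k < h k
agreeing-prefix⇒≮ {g = g} {h} g-inj h∈ h-inj h-asc {k} c≤k k<n prefix gk<hk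
  with Permutation.surjective h∈ h-inj (<-trans gk<hk (h∈ k<n))
... | j , j<n , hj≡gk with <-cmp j k
...   | tri< j<k _ _  = <⇒≢ j<k (g-inj j<n k<n (trans (prefix j<k) hj≡gk))
...   | tri≈ _ refl _ = <-irrefl (sym hj≡gk) gk<hk
...   | tri> _ _ k<j  = <-asym gk<hk (subst (h k <_) hj≡gk (ascending-< h-asc c≤k k<j j<n))

module _ {n c : ℕ} {g h : ℕ → ℕ}
         (g∈ : MapsInto n g) (g-inj : InjectiveOn n g) (g-asc : AscendingOn g c n)
         (h∈ : MapsInto n h) (h-inj : InjectiveOn n h) (h-asc : AscendingOn h c n) where

  ascending-suffix-determined : Agree c g h → Agree n g h
  ascending-suffix-determined prefix {i} i<n = agree-below (suc i) (n<1+n i) i<n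
    where
    agree-at : ∀ {k} → k < n → Agree k g h → g k ≡ h k
    agree-at {k} k<n below with k <? c
    ... | yes k<c = prefix k<c
    ... | no  k≮c with <-cmp (g k) (h k)
    ...   | tri< gk<hk _ _ = contradiction gk<hk (agreeing-prefix⇒≮ g-inj h∈ h-inj h-asc (≮⇒≥ k≮c) k<n below)
    ...   | tri≈ _ gk≡hk _ = gk≡hk
    ...   | tri> _ _ hk<gk = contradiction hk<gk
                               (agreeing-prefix⇒≮ h-inj g∈ g-inj g-asc (≮⇒≥ k≮c) k<n (λ j<k → sym (below j<k)))

    agree-below : ∀ k → ∀ {j} → j < k → j < n → g j ≡ h j
    agree-below (suc k) j<sk j<n with m≤n⇒m<n∨m≡n (s≤s⁻¹ j<sk)
    ... | inj₁ j<k  = agree-below k j<k j<n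
    ... | inj₂ refl = agree-at j<n (λ i<j → agree-below k i<j (<-trans i<j j<n))

-- Block swaps

-- Exchanges the adjacent blocks of positions [l, d] and [d + 1, d + w]; in one-line notation
-- 0 … (l-1) (l+w) … (d+w) l … (l+w-1) (d+w+1) …
blockSwap : ℕ → ℕ → ℕ → ℕ → ℕ
blockSwap l d w k with k <? l | k ≤? d | k ≤? d + w
... | yes _ | _     | _     = k
... | no  _ | yes _ | _     = k + w
... | no  _ | no  _ | yes _ = l + (k ∸ suc d)
... | no  _ | no  _ | no  _ = k

module BlockSwap {l d w : ℕ} (l≤d : l ≤ d) where

  f : ℕ → ℕ
  f = blockSwap l d w

  f-below : ∀ {k} → k < l → f k ≡ k
  f-below {k} k<l with k <? l
  ... | yes _   = refl
  ... | no  k≮l = contradiction k<l k≮l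

  f-raised : ∀ {k} → l ≤ k → k ≤ d → f k ≡ k + w
  f-raised {k} l≤k k≤d with k <? l | k ≤? d
  ... | yes k<l | _       = contradiction l≤k (<⇒≱ k<l)
  ... | no  _   | yes _   = refl
  ... | no  _   | no  k≰d = contradiction k≤d k≰d

  f-lowered : ∀ {k} → d < k → k ≤ d + w → f k ≡ l + (k ∸ suc d)
  f-lowered {k} d<k k≤d+w with k <? l | k ≤? d | k ≤? d + w
  ... | yes k<l | _       | _        = ⊥-elim (<-asym k<l (≤-<-trans l≤d d<k))
  ... | no  _   | yes k≤d | _        = contradiction d<k (≤⇒≯ k≤d)
  ... | no  _   | no  _   | yes _    = refl
  ... | no  _   | no  _   | no  k≰dw = contradiction k≤d+w k≰dw

  f-above : ∀ {k} → d + w < k → f k ≡ k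
  f-above {k} dw<k with k <? l | k ≤? d | k ≤? d + w
  ... | yes _   | _       | _       = refl
  ... | no  _   | yes k≤d | _       = contradiction (≤-<-trans (m≤m+n d w) dw<k) (≤⇒≯ k≤d)
  ... | no  _   | no  _   | yes k≤dw = contradiction dw<k (≤⇒≯ k≤dw)
  ... | no  _   | no  _   | no  _   = refl

  lowered-< : ∀ {k} → d < k → l + (k ∸ suc d) < k
  lowered-< {k} d<k = begin-strict
    l + (k ∸ suc d)     ≤⟨ +-monoˡ-≤ (k ∸ suc d) l≤d ⟩
    d + (k ∸ suc d)     <⟨ n<1+n _ ⟩
    suc d + (k ∸ suc d) ≡⟨ m+[n∸m]≡n d<k ⟩
    k                   ∎
    where open ≤-Reasoning

  lowered-<-l+w : ∀ {k} → d < k → k ≤ d + w → l + (k ∸ suc d) < l + w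
  lowered-<-l+w {k} d<k k≤d+w = +-monoʳ-< l (subst (k ∸ suc d <_) (m+n∸m≡n (suc d) w) (∸-monoˡ-< (s≤s k≤d+w) d<k))

  ascending₁ : AscendingOn f 0 (suc d)
  ascending₁ {i} _ si<sd with ≤-<-connex l i | ≤-<-connex l (suc i)
  ... | inj₁ l≤i | _         = subst₂ _<_ (sym (f-raised l≤i (<⇒≤ (s≤s⁻¹ si<sd))))
                                          (sym (f-raised (≤-trans l≤i (n≤1+n i)) (s≤s⁻¹ si<sd))) (n<1+n (i + w))
  ... | inj₂ i<l | inj₁ l≤si = subst₂ _<_ (sym (f-below i<l)) (sym (f-raised l≤si (s≤s⁻¹ si<sd)))
                                          (≤-trans (n<1+n i) (m≤m+n (suc i) w))
  ... | inj₂ i<l | inj₂ si<l = subst₂ _<_ (sym (f-below i<l)) (sym (f-below si<l)) (n<1+n i)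

  ascending₂ : ∀ {n} → AscendingOn f (suc d) n
  ascending₂ {_} {i} d<i _ with ≤-<-connex (suc i) (d + w) | ≤-<-connex i (d + w)
  ... | inj₁ si≤dw | _         = subst₂ _<_ (sym (f-lowered d<i (<⇒≤ si≤dw)))
                                            (sym (f-lowered (<-trans d<i (n<1+n i)) si≤dw))
                                            (+-monoʳ-< l (∸-monoˡ-< (n<1+n i) d<i))
  ... | inj₂ dw<si | inj₁ i≤dw = subst₂ _<_ (sym (f-lowered d<i i≤dw)) (sym (f-above dw<si))
                                            (<-trans (lowered-< d<i) (n<1+n i))
  ... | inj₂ _     | inj₂ dw<i = subst₂ _<_ (sym (f-above dw<i)) (sym (f-above (<-trans dw<i (n<1+n i)))) (n<1+n i)

  f-at-d : f d ≡ d + w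
  f-at-d = f-raised l≤d ≤-refl

  descent : 0 < w → Descent f d
  descent 0<w = subst₂ _<_ (sym f-at-suc-d) (sym f-at-d) (≤-<-trans l≤d (m<m+n d 0<w))
    where
    f-at-suc-d : f (suc d) ≡ l
    f-at-suc-d = trans (f-lowered (n<1+n d) (m<m+n d 0<w)) (trans (cong (l +_) (n∸n≡0 (suc d))) (+-identityʳ l))

  l≤block₂ : ∀ {k} → d < k → l ≤ f k
  l≤block₂ {k} d<k with ≤-<-connex k (d + w)
  ... | inj₁ k≤dw = subst (l ≤_) (sym (f-lowered d<k k≤dw)) (m≤m+n l _)
  ... | inj₂ dw<k = subst (l ≤_) (sym (f-above dw<k)) (<⇒≤ (≤-<-trans l≤d d<k))

  block₂-≤ : ∀ {k} → d < k → f k ≤ k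
  block₂-≤ {k} d<k with ≤-<-connex k (d + w)
  ... | inj₁ k≤dw = subst (_≤ k) (sym (f-lowered d<k k≤dw)) (<⇒≤ (lowered-< d<k))
  ... | inj₂ dw<k = ≤-reflexive (f-above dw<k)

  mapsInto : ∀ {n} → d + w < n → MapsInto n f
  mapsInto dw<n {k} k<n with ≤-<-connex k d | ≤-<-connex l k
  ... | inj₂ d<k | _        = ≤-<-trans (block₂-≤ d<k) k<n
  ... | inj₁ _   | inj₂ k<l = subst (_< _) (sym (f-below k<l)) k<n
  ... | inj₁ k≤d | inj₁ l≤k = subst (_< _) (sym (f-raised l≤k k≤d)) (≤-<-trans (+-monoˡ-≤ w k≤d) dw<n)

  separated : ∀ {n i j} → i ≤ d → d < j → j < n → f i ≢ f j
  separated {i = i} {j} i≤d d<j _ fi≡fj with ≤-<-connex l i | ≤-<-connex j (d + w)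
  ... | inj₂ i<l | _         = <-irrefl fi≡fj (<-≤-trans (subst (_< l) (sym (f-below i<l)) i<l) (l≤block₂ d<j))
  ... | inj₁ l≤i | inj₁ j≤dw = <-irrefl (sym fi≡fj) (subst₂ _<_ (sym (f-lowered d<j j≤dw)) (sym (f-raised l≤i i≤d))
                                  (<-≤-trans (lowered-<-l+w d<j j≤dw) (+-monoˡ-≤ w l≤i)))
  ... | inj₁ l≤i | inj₂ dw<j = <-irrefl fi≡fj (subst₂ _<_ (sym (f-raised l≤i i≤d)) (sym (f-above dw<j))
                                  (≤-<-trans (+-monoˡ-≤ w i≤d) dw<j))

  module Blocks {n : ℕ} = TwoBlocks {n} {d} {f} ascending₁ ascending₂

  grassmannian : ∀ {n} → d + w < n → MapsInto n f × InjectiveOn n f × AtMostOneDescent n f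
  grassmannian dw<n = mapsInto dw<n , Blocks.injective separated , Blocks.atMostOneDescent

-- Counting

atZero : ℕ → ℕ × ℕ
atZero t = 0 , t

parameters : ℕ → List (ℕ × ℕ)
parameters zero    = []
parameters (suc n) = map atZero (upTo n) ++ map (map₁ suc) (parameters n)

length-parameters : ∀ n → length (parameters n) ≡ n C 2
length-parameters zero    = refl
length-parameters (suc n) = begin
  length (map atZero (upTo n) ++ map (map₁ suc) (parameters n))
    ≡⟨ length-++ (map atZero (upTo n)) {map (map₁ suc) (parameters n)} ⟩
  length (map atZero (upTo n)) + length (map (map₁ suc) (parameters n))
    ≡⟨ cong₂ _+_ (trans (length-map _ (upTo n)) (length-upTo n))
                 (trans (length-map _ (parameters n)) (length-parameters n)) ⟩
  n + n C 2                                                      ≡⟨ cong (_+ n C 2) (nC1≡n n) ⟨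
  n C 1 + n C 2                                                  ≡⟨ nCk+nC[k+1]≡[n+1]C[k+1] n 1 ⟩
  suc n C 2                                                      ∎
  where open ≡-Reasoning

∈-parameters⇔ : ∀ {n d t} → (d , t) ∈ parameters n ⇔ d + suc t < n
∈-parameters⇔ = mk⇔ to′ from′
  where
  to′ : ∀ {n d t} → (d , t) ∈ parameters n → d + suc t < n
  to′ {suc n} p∈ with ∈-++⁻ (map atZero (upTo n)) p∈
  ... | inj₁ p∈₀ with ∈-map⁻ atZero p∈₀
  ...   | _ , t∈ , refl = s≤s (∈-upTo⁻ t∈)
  to′ {suc n} p∈ | inj₂ p∈₊ with ∈-map⁻ (map₁ suc) p∈₊
  ...   | _ , q∈ , refl = s≤s (to′ q∈)

  from′ : ∀ {n d t} → d + suc t < n → (d , t) ∈ parameters n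
  from′ {suc n} {zero}  st<sn = ∈-++⁺ˡ (∈-map⁺ atZero (∈-upTo⁺ (s≤s⁻¹ st<sn)))
  from′ {suc n} {suc d} sdst<sn = ∈-++⁺ʳ (map atZero (upTo n)) (∈-map⁺ (map₁ suc) (from′ (s≤s⁻¹ sdst<sn)))

parameters-unique : ∀ n → Unique (parameters n)
parameters-unique zero    = []
parameters-unique (suc n) =
  Unique.++⁺ (Unique.map⁺ (λ { refl → refl }) (Unique.upTo⁺ n))
             (Unique.map⁺ (λ { {_ , _} {_ , _} refl → refl }) (parameters-unique n))
             λ (p∈₀ , p∈₊) → disjoint (∈-map⁻ atZero p∈₀) (∈-map⁻ (map₁ suc) p∈₊)
  where
  disjoint : ∀ {p} → (∃ λ t → t ∈ upTo n × p ≡ (0 , t)) → (∃ λ q → q ∈ parameters n × p ≡ map₁ suc q) → ⊥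
  disjoint (_ , _ , refl) (_ , _ , ())

-- A non-identity avoider with descent at d will be the swap of the blocks [ℓ d, d] and
-- [d + 1, d + suc t]; the pairs (d , t) range over parameters n.
module Counting (σ : Vec (Fin 3) 3) (R : Pattern) (σ∼R : Realizes σ R)
  (identity-avoids : ∀ {i j k} → i < j → j < k → ¬ R i j k)
  (ℓ : ℕ → ℕ) (ℓ≤ : ∀ d → ℓ d ≤ d)
  (family-avoids : ∀ {n d t} → d + suc t < n → Avoids n R (blockSwap (ℓ d) d (suc t)))
  (first-block : ∀ {n g} → GrassmannianAvoider n R g → ∀ {d} → suc d < n → Descent g d →
                 ∃ λ t → Agree (suc d) g (blockSwap (ℓ d) d (suc t)))
  where

  open Characterisation σ R σ∼R

  family : ℕ × ℕ → ℕ → ℕ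
  family (d , t) = blockSwap (ℓ d) d (suc t)

  family-grassmannianAvoider : ∀ {n d t} → d + suc t < n → GrassmannianAvoider n R (family (d , t))
  family-grassmannianAvoider {d = d} dt<n =
    let f∈ , f-inj , f-one = BlockSwap.grassmannian (ℓ≤ d) dt<n
    in record { mapsInto = f∈ ; injective = f-inj ; atMostOneDescent = f-one ; avoids = family-avoids dt<n }

  family-mapsInto : ∀ {n p} → p ∈ parameters n → MapsInto n (family p)
  family-mapsInto p∈ = GrassmannianAvoider.mapsInto (family-grassmannianAvoider (to ∈-parameters⇔ p∈))

  classify : ∀ {n g} → GrassmannianAvoider n R g →
             Agree n g id ⊎ ∃ λ p → p ∈ parameters n × Agree n g (family p)
  classify {n} {g} ga = Sum.map ascending-case descent-case (Permutation.ascending-or-descent mapsInto injective)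
    where
    open GrassmannianAvoider ga

    ascending-case : AscendingOn g 0 n → Agree n g id
    ascending-case asc =
      ascending-suffix-determined mapsInto injective asc id (λ _ _ i≡j → i≡j) (λ {i} _ _ → n<1+n i) λ ()

    descent-case : (∃ λ d → suc d < n × Descent g d) → ∃ λ p → p ∈ parameters n × Agree n g (family p)
    descent-case (d , sd<n , dd) = (d , t) , from ∈-parameters⇔ dt<n ,
      ascending-suffix-determined mapsInto injective g-asc₂ f∈ f-inj (BlockSwap.ascending₂ (ℓ≤ d)) g≗f
      where
      t : ℕ
      t = proj₁ (first-block ga sd<n dd)
      g≗f : Agree (suc d) g (family (d , t))
      g≗f = proj₂ (first-block ga sd<n dd)
      dt<n : d + suc t < n
      dt<n = subst (_< n) (trans (g≗f (n<1+n d)) (BlockSwap.f-at-d (ℓ≤ d))) (mapsInto (<-trans (n<1+n d) sd<n))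
      g-asc₂ : AscendingOn g (suc d) n
      g-asc₂ = proj₂ (Permutation.ascending-blocks mapsInto injective atMostOneDescent sd<n dd)
      f∈ : MapsInto n (family (d , t))
      f∈ = GrassmannianAvoider.mapsInto (family-grassmannianAvoider dt<n)
      f-inj : InjectiveOn n (family (d , t))
      f-inj = GrassmannianAvoider.injective (family-grassmannianAvoider dt<n)

  family-determines-parameters : ∀ {n p q} → p ∈ parameters n → q ∈ parameters n →
                                 Agree n (family p) (family q) → p ≡ q
  family-determines-parameters {n} {d , t} {d′ , t′} p∈ q∈ fp≗fq
    with GrassmannianAvoider.atMostOneDescent (family-grassmannianAvoider dt′<n) sd<n sd′<n
           (subst₂ _<_ (fp≗fq sd<n) (fp≗fq (<-trans (n<1+n d) sd<n)) (BlockSwap.descent (ℓ≤ d) z<s))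
           (BlockSwap.descent (ℓ≤ d′) z<s)
    where
    dt′<n : d′ + suc t′ < n
    dt′<n = to ∈-parameters⇔ q∈
    sd<n : suc d < n
    sd<n = ≤-<-trans (m<m+n d z<s) (to ∈-parameters⇔ p∈)
    sd′<n : suc d′ < n
    sd′<n = ≤-<-trans (m<m+n d′ z<s) dt′<n
  ... | refl = cong (d ,_) (suc-injective (+-cancelˡ-≡ d _ _ (begin
    d + suc t          ≡⟨ BlockSwap.f-at-d (ℓ≤ d) ⟨
    family (d , t) d   ≡⟨ fp≗fq (<-trans (m<m+n d z<s) (to ∈-parameters⇔ p∈)) ⟩
    family (d , t′) d  ≡⟨ BlockSwap.f-at-d (ℓ≤ d) ⟩
    d + suc t′         ∎)))
    where open ≡-Reasoning

  family-not-identity : ∀ {n p} → p ∈ parameters n → ¬ Agree n (family p) id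
  family-not-identity {n} {d , t} p∈ fp≗id =
    <-asym (subst₂ _<_ (fp≗id sd<n) (fp≗id (<-trans (n<1+n d) sd<n)) (BlockSwap.descent (ℓ≤ d) z<s)) (n<1+n d)
    where
    sd<n : suc d < n
    sd<n = ≤-<-trans (m<m+n d z<s) (to ∈-parameters⇔ p∈)

  members : (n : ℕ) → List (Vec (Fin n) n)
  members n = fromFun n id ∷ map (fromFun n ∘′ family) (parameters n)

  members-unique : ∀ n → Unique (members n)
  members-unique n =
    AllP.map⁺ (All.tabulate λ {p} p∈ e → family-not-identity p∈ (λ i<n →
      sym (fromFun-injective id (family-mapsInto p∈) e i<n)))
    ∷ map⁺-injectiveOn (parameters-unique n) λ p∈ q∈ e →
        family-determines-parameters p∈ q∈ (fromFun-injective (family-mapsInto p∈) (family-mapsInto q∈) e)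

  grassAvoiding⊆members : ∀ {n} → grassAvoiding n σ ⊆ members n
  grassAvoiding⊆members {n} {π} π∈ =
    [ identity-member , family-member ]′ (classify (to (∈-grassAvoiding⇔ {π = π}) π∈))
    where
    identity-member : Agree n ⟦ π ⟧ id → π ∈ members n
    identity-member π≗id = here (≡fromFun id π≗id)
    family-member : (∃ λ p → p ∈ parameters n × Agree n ⟦ π ⟧ (family p)) → π ∈ members n
    family-member (p , p∈ , π≗fp) =
      there (subst (_∈ map (fromFun n ∘′ family) (parameters n))
                   (sym (≡fromFun (family-mapsInto p∈) π≗fp)) (∈-map⁺ _ p∈))

  members⊆grassAvoiding : ∀ {n} → members n ⊆ grassAvoiding n σ
  members⊆grassAvoiding (here refl) = from ∈-grassAvoiding⇔
    (GrassmannianAvoider-resp (λ i<n → sym (⟦fromFun⟧ id i<n)) (identity-grassmannianAvoider identity-avoids))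
  members⊆grassAvoiding {n} (there π∈) with ∈-map⁻ (fromFun n ∘′ family) π∈
  ... | p , p∈ , refl = from ∈-grassAvoiding⇔
    (GrassmannianAvoider-resp (λ i<n → sym (⟦fromFun⟧ (family-mapsInto p∈) i<n))
      (family-grassmannianAvoider (to ∈-parameters⇔ p∈)))

  count : ∀ n → length (grassAvoiding n σ) ≡ 1 + n C 2
  count n = begin
    length (grassAvoiding n σ)  ≡⟨ ≤-antisym (length-mono-⊆ (grassAvoiding-unique {n}) grassAvoiding⊆members)
                                             (length-mono-⊆ (members-unique n) members⊆grassAvoiding) ⟩
    length (members n)          ≡⟨ cong suc (length-map _ (parameters n)) ⟩
    1 + length (parameters n)   ≡⟨ cong suc (length-parameters n) ⟩
    1 + n C 2                   ∎
    where open ≡-Reasoning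

-- The patterns 132 and 231

blockSwap-avoids132 : ∀ {n d w} → Avoids n Is132 (blockSwap 0 d w)
blockSwap-avoids132 {n} {d} {w} {i} {j} {k} i<j j<k k<n (fi<fk , fk<fj)
  with Blocks.inversion-straddles {n} j<k k<n fk<fj | ≤-<-connex k (d + w)
  where open BlockSwap {0} {d} {w} z≤n
... | j≤d , d<k | inj₁ k≤dw = <-asym fi<fk (subst₂ _<_ (sym (f-lowered d<k k≤dw)) (sym (f-raised z≤n i≤d))
                                (≤-trans (lowered-<-l+w d<k k≤dw) (m≤n+m w i)))
  where
  open BlockSwap {0} {d} {w} z≤n
  i≤d : i ≤ d
  i≤d = ≤-trans (<⇒≤ i<j) j≤d
... | j≤d , d<k | inj₂ dw<k = <-asym fk<fj (subst₂ _<_ (sym (f-raised z≤n j≤d)) (sym (f-above dw<k))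
                                (≤-<-trans (+-monoˡ-≤ w j≤d) dw<k))
  where open BlockSwap {0} {d} {w} z≤n

module FirstBlock132 {n g} (ga : GrassmannianAvoider n Is132 g) {d} (sd<n : suc d < n) (dd : Descent g d) where

  open GrassmannianAvoider ga
  open Permutation mapsInto injective

  asc₁ : AscendingOn g 0 (suc d)
  asc₁ = proj₁ (ascending-blocks atMostOneDescent sd<n dd)

  -- A value strictly between g i and g (i + 1) would sit after the first block, forming a 132.
  consecutive : ∀ {i} → i < d → g (suc i) ≡ suc (g i)
  consecutive {i} i<d with m≤n⇒m<n∨m≡n (asc₁ z≤n (s≤s i<d))
  ... | inj₂ sgi≡gsi = sym sgi≡gsi
  ... | inj₁ gap with surjective (<-trans gap (mapsInto (<-trans (s≤s i<d) sd<n)))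
  ...   | j , j<n , gj≡sgi with ≤-<-connex j i | ≤-<-connex j d
  ...     | inj₁ j≤i | _       = contradiction (ascending-≤ asc₁ z≤n j≤i (<-trans i<d (n<1+n d)))
                                   (<⇒≱ (subst (g i <_) (sym gj≡sgi) (n<1+n (g i))))
  ...     | inj₂ i<j | inj₁ j≤d = contradiction (ascending-≤ asc₁ z≤n i<j (s≤s j≤d))
                                   (<⇒≱ (subst (_< g (suc i)) (sym gj≡sgi) gap))
  ...     | inj₂ _   | inj₂ d<j = ⊥-elim (avoids (n<1+n i) (≤-<-trans i<d d<j) j<n
                                   (subst (g i <_) (sym gj≡sgi) (n<1+n (g i)) , subst (_< g (suc i)) (sym gj≡sgi) gap))

  arithmetic : ∀ {i} → i ≤ d → g i ≡ g 0 + i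
  arithmetic {zero}  _    = sym (+-identityʳ (g 0))
  arithmetic {suc i} si≤d = begin
    g (suc i)        ≡⟨ consecutive si≤d ⟩
    suc (g i)        ≡⟨ cong suc (arithmetic (<⇒≤ si≤d)) ⟩
    suc (g 0 + i)    ≡⟨ +-suc (g 0) i ⟨
    g 0 + suc i      ∎
    where open ≡-Reasoning

  g0≢0 : g 0 ≢ 0
  g0≢0 g0≡0 = fixed-prefix⇒no-descent sd<n (λ i≤d → trans (arithmetic i≤d) (cong (_+ _) g0≡0)) dd

  first-block : ∃ λ t → Agree (suc d) g (blockSwap 0 d (suc t))
  first-block with g 0 | g0≢0 | arithmetic
  ... | zero    | 0≢0   | _      = contradiction refl 0≢0
  ... | suc t   | _     | arith = t , λ {i} i<sd → trans (arith (s≤s⁻¹ i<sd))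
                                    (trans (+-comm (suc t) i) (sym (BlockSwap.f-raised z≤n z≤n (s≤s⁻¹ i<sd))))

blockSwap-avoids231 : ∀ {n d w} → Avoids n Is231 (blockSwap d d w)
blockSwap-avoids231 {n} {d} {w} {i} {j} {k} i<j j<k k<n (fk<fi , fi<fj) =
  <-asym fk<fi (<-≤-trans (subst (_< d) (sym (f-below i<d)) i<d) (l≤block₂ d<k))
  where
  open BlockSwap {d} {d} {w} ≤-refl
  d<k : d < k
  d<k = proj₂ (Blocks.inversion-straddles {n} (<-trans i<j j<k) k<n fk<fi)
  i<d : i < d
  i<d = <-≤-trans i<j (proj₁ (Blocks.inversion-straddles {n} j<k k<n (<-trans fk<fi fi<fj)))

module FirstBlock231 {n g} (ga : GrassmannianAvoider n Is231 g) {d} (sd<n : suc d < n) (dd : Descent g d) where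

  open GrassmannianAvoider ga
  open Permutation mapsInto injective

  asc₁ : AscendingOn g 0 (suc d)
  asc₁ = proj₁ (ascending-blocks atMostOneDescent sd<n dd)

  -- If g j < g i with i < d < j, then g j < g i < g d is a 231.
  left-minima : ∀ {i j} → i < d → i < j → j < n → g i < g j
  left-minima {i} {j} i<d i<j j<n with ≤-<-connex j d | <-cmp (g i) (g j)
  ... | inj₁ j≤d | _              = ascending-< asc₁ z≤n i<j (s≤s j≤d)
  ... | inj₂ _   | tri< gi<gj _ _ = gi<gj
  ... | inj₂ _   | tri≈ _ gi≡gj _ = contradiction (injective (<-trans i<j j<n) j<n gi≡gj) (<⇒≢ i<j)
  ... | inj₂ d<j | tri> _ _ gj<gi = ⊥-elim (avoids i<d d<j j<n (gj<gi , ascending-< asc₁ z≤n i<d (n<1+n d)))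

  prefix : Agree d g id
  prefix = left-minima⇒fixed (<⇒≤ (<-trans (n<1+n d) sd<n)) left-minima

  d<gd : d < g d
  d<gd with <-cmp d (g d)
  ... | tri< d<gd _ _ = d<gd
  ... | tri≈ _ d≡gd _ = contradiction dd (fixed-prefix⇒no-descent sd<n fixed)
    where
    fixed : ∀ {i} → i ≤ d → g i ≡ i
    fixed i≤d with m≤n⇒m<n∨m≡n i≤d
    ... | inj₁ i<d  = prefix i<d
    ... | inj₂ refl = sym d≡gd
  ... | tri> _ _ gd<d = contradiction (injective (<-trans gd<d d<n) d<n (prefix gd<d)) (<⇒≢ gd<d)
    where
    d<n : d < n
    d<n = <-trans (n<1+n d) sd<n

  first-block : ∃ λ t → Agree (suc d) g (blockSwap d d (suc t))
  first-block = g d ∸ suc d , agree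
    where
    open BlockSwap {d} {d} {suc (g d ∸ suc d)} ≤-refl
    agree : Agree (suc d) g f
    agree i<sd with m≤n⇒m<n∨m≡n (s≤s⁻¹ i<sd)
    ... | inj₁ i<d  = trans (prefix i<d) (sym (f-below i<d))
    ... | inj₂ refl = sym (trans f-at-d (trans (+-suc d _) (m+[n∸m]≡n d<gd)))

count132 : ∀ n → length (grassAvoiding n p132) ≡ 1 + n C 2
count132 = Counting.count p132 Is132 realizes132 (λ _ j<k (_ , k<j) → <-asym j<k k<j)
  (λ _ → 0) (λ _ → z≤n) (λ {n} {d} {t} _ → blockSwap-avoids132 {n} {d} {suc t}) FirstBlock132.first-block

count231 : ∀ n → length (grassAvoiding n p231) ≡ 1 + n C 2
count231 = Counting.count p231 Is231 realizes231 (λ i<j j<k (k<i , _) → <-asym k<i (<-trans i<j j<k))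
  id (λ _ → ≤-refl) (λ {n} {d} {t} _ → blockSwap-avoids231 {n} {d} {suc t}) FirstBlock231.first-block

-- The patterns 213 and 312

reverseComplement : ℕ → (ℕ → ℕ) → ℕ → ℕ
reverseComplement N g i = N ∸ g (N ∸ i)

ReverseComplement : Pattern → Pattern → Set
ReverseComplement R S = ∀ {N x y z} → x ≤ N → y ≤ N → z ≤ N → S x y z → R (N ∸ z) (N ∸ y) (N ∸ x)

module ReverseComplementOf {N : ℕ} {g : ℕ → ℕ} (g∈ : MapsInto (suc N) g) where

  h : ℕ → ℕ
  h = reverseComplement N g

  private
    g≤N : ∀ {i} → i ≤ N → g i ≤ N
    g≤N i≤N = s≤s⁻¹ (g∈ (s≤s i≤N))

    N∸≤N : ∀ i → N ∸ i ≤ N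
    N∸≤N i = m∸n≤m N i

  N∸h : ∀ i → N ∸ h i ≡ g (N ∸ i)
  N∸h i = m∸[m∸n]≡n (g≤N (N∸≤N i))

  h-mapsInto : MapsInto (suc N) h
  h-mapsInto {i} _ = s≤s (N∸≤N (g (N ∸ i)))

  h-involutive : Agree (suc N) (reverseComplement N h) g
  h-involutive {i} i<sN = trans (N∸h (N ∸ i)) (cong g (m∸[m∸n]≡n (s≤s⁻¹ i<sN)))

  h-injective : InjectiveOn (suc N) g → InjectiveOn (suc N) h
  h-injective g-inj {i} {j} i<sN j<sN hi≡hj = ∸-cancelˡ-≡ (s≤s⁻¹ i<sN) (s≤s⁻¹ j<sN)
    (g-inj (s≤s (N∸≤N i)) (s≤s (N∸≤N j)) (∸-cancelˡ-≡ (g≤N (N∸≤N i)) (g≤N (N∸≤N j)) hi≡hj))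

  h-descent : ∀ {i} → suc i < suc N → Descent h i → Descent g (N ∸ suc i)
  h-descent {i} si<sN dh = subst (λ k → g k < g (N ∸ suc i)) (+-∸-assoc 1 (s≤s⁻¹ si<sN)) (∸-cancelʳ-< dh)

  h-atMostOneDescent : AtMostOneDescent (suc N) g → AtMostOneDescent (suc N) h
  h-atMostOneDescent g-one {i} {j} si<sN sj<sN di dj = suc-injective (∸-cancelˡ-≡ (s≤s⁻¹ si<sN) (s≤s⁻¹ sj<sN)
    (g-one (bound si<sN) (bound sj<sN) (h-descent si<sN di) (h-descent sj<sN dj)))
    where
    bound : ∀ {i} → suc i < suc N → suc (N ∸ suc i) < suc N
    bound {i} si<sN = subst (_< suc N) (+-∸-assoc 1 (s≤s⁻¹ si<sN)) (s≤s (N∸≤N i))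

  h-avoids : ∀ {R S} → ReverseComplement R S → Avoids (suc N) R g → Avoids (suc N) S h
  h-avoids {R} {S} R∼S g-avoids {i} {j} {k} i<j j<k k<sN s =
    g-avoids (∸-monoʳ-< j<k k≤N) (∸-monoʳ-< i<j j≤N) (s≤s (N∸≤N i))
      (resp₃ R (N∸h k) (N∸h j) (N∸h i) (R∼S {N} (N∸≤N (g (N ∸ i))) (N∸≤N (g (N ∸ j))) (N∸≤N (g (N ∸ k))) s))
    where
    k≤N = s≤s⁻¹ k<sN
    j≤N = ≤-trans (<⇒≤ j<k) k≤N

  h-grassmannianAvoider : ∀ {R S} → ReverseComplement R S →
                          GrassmannianAvoider (suc N) R g → GrassmannianAvoider (suc N) S h
  h-grassmannianAvoider {R} {S} R∼S ga = record
    { mapsInto         = h-mapsInto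
    ; injective        = h-injective injective
    ; atMostOneDescent = h-atMostOneDescent atMostOneDescent
    ; avoids           = h-avoids {R} {S} R∼S avoids
    }
    where open GrassmannianAvoider ga

module _ {N : ℕ} where

  private
    module RC (π : Vec (Fin (suc N)) (suc N)) = ReverseComplementOf (⟦⟧-mapsInto π)

  reverseComplementᵛ : Vec (Fin (suc N)) (suc N) → Vec (Fin (suc N)) (suc N)
  reverseComplementᵛ π = fromFun (suc N) (RC.h π)

  reverseComplementᵛ-injective : ∀ {π ρ} → reverseComplementᵛ π ≡ reverseComplementᵛ ρ → π ≡ ρ
  reverseComplementᵛ-injective {π} {ρ} e = ⟦⟧-injective λ {i} i<sN → begin
    ⟦ π ⟧ i             ≡⟨ RC.h-involutive π i<sN ⟨
    N ∸ RC.h π (N ∸ i)  ≡⟨ cong (N ∸_) (hπ≗hρ (s≤s (m∸n≤m N i))) ⟩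
    N ∸ RC.h ρ (N ∸ i)  ≡⟨ RC.h-involutive ρ i<sN ⟩
    ⟦ ρ ⟧ i             ∎
    where
    open ≡-Reasoning
    hπ≗hρ : Agree (suc N) (RC.h π) (RC.h ρ)
    hπ≗hρ = fromFun-injective (RC.h-mapsInto π) (RC.h-mapsInto ρ) e

  length-grassAvoiding-≤ : ∀ {σ R τ S} → Realizes σ R → Realizes τ S → ReverseComplement R S →
                           length (grassAvoiding (suc N) σ) ≤ length (grassAvoiding (suc N) τ)
  length-grassAvoiding-≤ {σ} {R} {τ} {S} σ∼R τ∼S R∼S = begin
    length (grassAvoiding (suc N) σ)
      ≡⟨ length-map reverseComplementᵛ (grassAvoiding (suc N) σ) ⟨
    length (map reverseComplementᵛ (grassAvoiding (suc N) σ))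
      ≤⟨ length-mono-⊆ (Unique.map⁺ reverseComplementᵛ-injective (Characterisation.grassAvoiding-unique σ R σ∼R))
                       image⊆ ⟩
    length (grassAvoiding (suc N) τ)
      ∎
    where
    open ≤-Reasoning
    image⊆ : map reverseComplementᵛ (grassAvoiding (suc N) σ) ⊆ grassAvoiding (suc N) τ
    image⊆ x∈ with ∈-map⁻ reverseComplementᵛ x∈
    ... | π , π∈ , refl = from (Characterisation.∈-grassAvoiding⇔ τ S τ∼S)
      (GrassmannianAvoider-resp (λ i<sN → sym (⟦fromFun⟧ (RC.h-mapsInto π) i<sN))
        (RC.h-grassmannianAvoider π R∼S (to (Characterisation.∈-grassAvoiding⇔ σ R σ∼R) π∈)))

count-reverseComplement : ∀ {R S} σ τ → Realizes σ R → Realizes τ S →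
  ReverseComplement R S → ReverseComplement S R →
  (∀ n → length (grassAvoiding n σ) ≡ 1 + n C 2) → ∀ n → length (grassAvoiding n τ) ≡ 1 + n C 2
count-reverseComplement _ _ _ _ _ _ _ zero = refl
count-reverseComplement {R} {S} σ τ σ∼R τ∼S R∼S S∼R count-σ (suc N) =
  trans (≤-antisym (length-grassAvoiding-≤ {N} {τ} {S} {σ} {R} τ∼S σ∼R S∼R)
                   (length-grassAvoiding-≤ {N} {σ} {R} {τ} {S} σ∼R τ∼S R∼S))
        (count-σ (suc N))

reverseComplement-132-213 : ReverseComplement Is132 Is213
reverseComplement-132-213 x≤N _ z≤N (y<x , x<z) = ∸-monoʳ-< x<z z≤N , ∸-monoʳ-< y<x x≤N

reverseComplement-213-132 : ReverseComplement Is213 Is132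
reverseComplement-213-132 _ y≤N z≤N (x<z , z<y) = ∸-monoʳ-< z<y y≤N , ∸-monoʳ-< x<z z≤N

reverseComplement-231-312 : ReverseComplement Is231 Is312
reverseComplement-231-312 x≤N _ z≤N (y<z , z<x) = ∸-monoʳ-< z<x x≤N , ∸-monoʳ-< y<z z≤N

reverseComplement-312-231 : ReverseComplement Is312 Is231
reverseComplement-312-231 x≤N y≤N _ (z<x , x<y) = ∸-monoʳ-< x<y y≤N , ∸-monoʳ-< z<x x≤N

count213 : ∀ n → length (grassAvoiding n p213) ≡ 1 + n C 2
count213 = count-reverseComplement p132 p213 realizes132 realizes213
  reverseComplement-132-213 reverseComplement-213-132 count132

count312 : ∀ n → length (grassAvoiding n p312) ≡ 1 + n C 2
count312 = count-reverseComplement p231 p312 realizes231 realizes312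
  reverseComplement-231-312 reverseComplement-312-231 count231

mainTheorem5 : (σ : Vec (Fin 3) 3) → σ ∈ (p132 ∷ p213 ∷ p231 ∷ p312 ∷ []) →
    (n : ℕ) → length (grassAvoiding n σ) ≡ 1 + n C 2
mainTheorem5 _ (here refl)                         = count132
mainTheorem5 _ (there (here refl))                 = count213
mainTheorem5 _ (there (there (here refl)))         = count231
mainTheorem5 _ (there (there (there (here refl)))) = count312
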